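{- Let $\psi$ be a path formula (an $\mathrm{LTL}$ formula) and let $x$ be an atomic proposition occurring in $\psi$. Then for every Kripke structure $K$ whose atomic propositions do not include $x$, $$K\models_T \forall x\, A\psi \iff K\models_b \forall x\, A\psi.$$
   Context: A Kripke structure $K=(AP,S,R,s_0,I)$ consists of atomic propositions $AP$, a finite set $S$ of states, a total transition relation $R\subseteq S\times S$, an initial state $s_0$ and labeling $I:S\to 2^{AP}$; $\mathrm{CTL}^*$ has the standard semantics (also over infinite structures such as trees), and $K\models\varphi$ means $K,s_0\models\varphi$. The computation tree $T(K)$ is the (possibly infinite) $S$-labeled tree obtained by unrolling $K$ from $s_0$: the root is labeled $s_0$ and each node labeled $s$ has exactly one child labeled $t$ for each $R$-successor $t$ of $s$; its propositional labeling is inherited from $K$. For a structure $M$ with atomic propositions $AP$ and $x\notin AP$, an $x$-variant of $M$ is a structure identical to $M$ except that it has atomic propositions $AP\cup\{x\}$ with an arbitrary labeling of $x$ on the states. Tree semantics: $K\models_T\forall x\,\varphi$ iff every $x$-variant of $T(K)$ satisfies $\varphi$. $K'$ is $x$-bisimilar to $K$ iff $K'$ has atomic propositions $AP\cup\{x\}$ and there is a relation between states relating the initial states such that related states agree on $AP$ and each transition from one of two related states is matched by a transition of the other to a related state (in both directions); $\mathcal{B}_x(K)$ is the set of all Kripke structures $x$-bisimilar to $K$. Bisimulation semantics: $K\models_b\forall x\,\varphi$ iff $K'\models\varphi$ for all $K'\in\mathcal{B}_x(K)$. -}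

module Defs where

open import Data.Nat using (ℕ; zero; suc; _+_; _<_; _≡ᵇ_)
open import Data.Fin using (Fin)
open import Data.Bool using (Bool; true; false; if_then_else_)
open import Data.List using (List)
open import Data.List.Membership.Propositional using (_∈_; _∉_)
open import Data.Product using (Σ; ∃; ∃-syntax; _×_; _,_)
open import Data.Sum using (_⊎_)
open import Data.Unit using (⊤)
open import Data.Empty using (⊥)
open import Relation.Nullary using (¬_)
open import Relation.Binary.PropositionalEquality using (_≡_)
open import Function.Bundles using (_⇔_)

data LTL : Set where
  ⊤ₗ   : LTL
  atom : ℕ → LTL
  ¬ₗ_  : LTL → LTL
  _∧ₗ_ : LTL → LTL → LTL
  Xₗ_  : LTL → LTL
  _Uₗ_ : LTL → LTL → LTL

Occurs : ℕ → LTL → Set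
Occurs x ⊤ₗ        = ⊥
Occurs x (atom p)  = p ≡ x
Occurs x (¬ₗ ψ)    = Occurs x ψ
Occurs x (ψ ∧ₗ φ)  = Occurs x ψ ⊎ Occurs x φ
Occurs x (Xₗ ψ)    = Occurs x ψ
Occurs x (ψ Uₗ φ)  = Occurs x ψ ⊎ Occurs x φ

-- General (possibly infinite) transition structures, used for the
-- semantics over Kripke structures and over computation trees.

record Structure : Set₁ where
  field
    State : Set
    _⟶_   : State → State → Set
    init  : State
    label : State → ℕ → Bool

module _ (M : Structure) where
  open Structure M

  IsPath : State → (ℕ → State) → Set
  IsPath s π = (π 0 ≡ s) × (∀ i → π i ⟶ π (suc i))

  _,_⊨ₚ_ : (ℕ → State) → ℕ → LTL → Set
  π , i ⊨ₚ ⊤ₗ      = ⊤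
  π , i ⊨ₚ atom p  = label (π i) p ≡ true
  π , i ⊨ₚ (¬ₗ ψ)  = ¬ (π , i ⊨ₚ ψ)
  π , i ⊨ₚ (ψ ∧ₗ φ) = (π , i ⊨ₚ ψ) × (π , i ⊨ₚ φ)
  π , i ⊨ₚ (Xₗ ψ)  = π , suc i ⊨ₚ ψ
  π , i ⊨ₚ (ψ Uₗ φ) =
    ∃[ k ] ((π , k + i ⊨ₚ φ) × (∀ j → j < k → π , j + i ⊨ₚ ψ))

  SatA : State → LTL → Set
  SatA s ψ = ∀ π → IsPath s π → π , 0 ⊨ₚ ψ

_⊨A_ : Structure → LTL → Set
M ⊨A ψ = SatA M (Structure.init M) ψ

variant : (M : Structure) → ℕ → (Structure.State M → Bool) → Structure
variant M x ℓ = record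
  { State = State ; _⟶_ = _⟶_ ; init = init
  ; label = λ s p → if p ≡ᵇ x then ℓ s else label s p }
  where open Structure M

record Kripke : Set where
  field
    AP    : List ℕ
    n     : ℕ
    R     : Fin n → Fin n → Bool
    total : ∀ s → ∃[ t ] (R s t ≡ true)
    s₀    : Fin n
    I     : Fin n → ℕ → Bool
    I-AP  : ∀ s p → I s p ≡ true → p ∈ AP   -- I : S → 2^AP

toStructure : Kripke → Structure
toStructure K = record
  { State = Fin n ; _⟶_ = λ s t → R s t ≡ true ; init = s₀ ; label = I }
  where open Kripke K

_⊨K_ : Kripke → LTL → Set
K ⊨K ψ = toStructure K ⊨A ψ

-- Computation tree T(K): nodes are the finite R-paths from s₀;
-- Node K s is the type of nodes labelled by state s.

module _ (K : Kripke) where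
  open Kripke K

  data Node : Fin n → Set where
    root  : Node s₀
    child : ∀ {s} → Node s → (t : Fin n) → R s t ≡ true → Node t

  data TreeEdge : Σ (Fin n) Node → Σ (Fin n) Node → Set where
    edge : ∀ {s} (ν : Node s) (t : Fin n) (r : R s t ≡ true) →
           TreeEdge (s , ν) (t , child ν t r)

  T : Structure
  T = record
    { State = Σ (Fin n) Node
    ; _⟶_   = TreeEdge
    ; init  = (s₀ , root)
    ; label = λ { (s , _) → I s } }

_⊨T∀_·A_ : Kripke → ℕ → LTL → Set
K ⊨T∀ x ·A ψ = ∀ (ℓ : Structure.State (T K) → Bool) → variant (T K) x ℓ ⊨A ψ

record IsXBisim (x : ℕ) (K K' : Kripke) (Z : Fin (Kripke.n K') → Fin (Kripke.n K) → Set) : Set where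
  private
    module K  = Kripke K
    module K' = Kripke K'
  field
    init  : Z K'.s₀ K.s₀
    agree : ∀ {s' s} → Z s' s → ∀ p → p ∈ K.AP → K'.I s' p ≡ K.I s p
    forth : ∀ {s' s t'} → Z s' s → K'.R s' t' ≡ true →
            ∃[ t ] ((K.R s t ≡ true) × Z t' t)
    back  : ∀ {s' s t} → Z s' s → K.R s t ≡ true →
            ∃[ t' ] ((K'.R s' t' ≡ true) × Z t' t)

XBisimilar : ℕ → Kripke → Kripke → Set₁
XBisimilar x K K' =
  (∀ p → p ∈ Kripke.AP K' ⇔ (p ∈ Kripke.AP K ⊎ p ≡ x)) ×
  Σ (Fin (Kripke.n K') → Fin (Kripke.n K) → Set) (IsXBisim x K K')

_⊨b∀_·A_ : Kripke → ℕ → LTL → Set₁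
K ⊨b∀ x ·A ψ = ∀ (K' : Kripke) → XBisimilar x K K' → K' ⊨K ψ

module Submission where

-- Both sides quantify over paths, and a path formula only sees the sequence
-- of labels along a path (⊨ₚ-transfer).  So it suffices to match traces:
--  * (⇒) Given K' ∈ B_x(K) and a path π' of K', the bisimulation yields a
--    Z-related path π of K (simulate), which unwinds to a branch of T(K)
--    (branch).  Labelling every tree node at depth i with the value of x at
--    π' i gives an x-variant of T(K) whose branch has the trace of π'
--    (bisim-path⇒tree-path).
--  * (⇐) Given an x-labelling ℓ of T(K) and a branch τ, the structure
--    K × Bool (module Doubling), whose bit is the value of x and whose
--    transitions ignore the bit, is x-bisimilar to K when x ∉ AP, and the
--    branch with its ℓ-bits is a path of it with the same trace
--    (tree-path⇒bisim-path).

open import Defs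
open import Data.Nat using (ℕ; zero; suc; _+_; _≡ᵇ_; _≟_)
open import Data.Nat.Properties using (≡ᵇ⇒≡; ≡⇒≡ᵇ)
open import Data.Bool using (Bool; true; false; if_then_else_)
open import Data.Bool.Properties using (T-≡)
open import Data.Unit using (tt)
open import Data.Empty using (⊥-elim)
open import Data.Product using (Σ-syntax; ∃-syntax; _×_; _,_; proj₁; proj₂)
open import Data.Sum using (_⊎_; inj₁; inj₂; [_,_]′)
open import Data.Fin using (Fin; splitAt; join)
open import Data.Fin.Properties using (splitAt-join)
open import Data.List using (_∷_)
open import Data.List.Membership.Propositional using (_∈_; _∉_)
open import Data.List.Membership.DecPropositional _≟_ using (_∈?_)
open import Data.List.Relation.Unary.Any using (here; there)
open import Function using (_∘_)
open import Function.Bundles using (_⇔_; mk⇔; Equivalence)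
open import Relation.Binary.PropositionalEquality
  using (_≡_; _≢_; refl; sym; trans; cong; cong₂; subst; subst₂)
open import Relation.Nullary using (¬_; yes; no)

false-unless : ∀ {b} {P : Set} → (b ≡ true → P) → ¬ P → b ≡ false
false-unless {false} _ _ = refl
false-unless {true} b⇒P ¬P = ⊥-elim (¬P (b⇒P refl))

-- The labelling L with the value of x overridden by b; an x-variant
-- 'variant M x ℓ' labels s by 'setX x (ℓ s) (label s)'.
setX : ℕ → Bool → (ℕ → Bool) → ℕ → Bool
setX x b L p = if p ≡ᵇ x then b else L p

setX-at : ∀ x b L → setX x b L x ≡ b
setX-at x b L rewrite Equivalence.to T-≡ (≡⇒≡ᵇ x x refl) = refl

setX-off : ∀ {x p} b L → p ≢ x → setX x b L p ≡ L p
setX-off {x} {p} b L p≢x with p ≡ᵇ x in p≡ᵇx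
... | true  = ⊥-elim (p≢x (≡ᵇ⇒≡ p x (Equivalence.from T-≡ p≡ᵇx)))
... | false = refl

setX-support : ∀ {x b L A} → (∀ p → L p ≡ true → p ∈ A) →
  ∀ p → setX x b L p ≡ true → p ∈ x ∷ A
setX-support {x} L⊆A p holds with p ≡ᵇ x in p≡ᵇx
... | true  = here (≡ᵇ⇒≡ p x (Equivalence.from T-≡ p≡ᵇx))
... | false = there (L⊆A p holds)

SameTrace : (M N : Structure) →
  (ℕ → Structure.State M) → (ℕ → Structure.State N) → Set
SameTrace M N π τ = ∀ i p → Structure.label M (π i) p ≡ Structure.label N (τ i) p

SameTrace-sym : ∀ {M N π τ} → SameTrace M N π τ → SameTrace N M τ π
SameTrace-sym same i p = sym (same i p)

⊨ₚ-transfer : ∀ {M N π τ} → SameTrace M N π τ →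
  ∀ ψ i → _,_⊨ₚ_ M π i ψ → _,_⊨ₚ_ N τ i ψ
⊨ₚ-transfer same ⊤ₗ       i _        = tt
⊨ₚ-transfer same (atom p) i holds    = trans (sym (same i p)) holds
⊨ₚ-transfer {M} {N} {π} {τ} same (¬ₗ ψ) i ¬holds h =
  ¬holds (⊨ₚ-transfer (SameTrace-sym {M} {N} {π} {τ} same) ψ i h)
⊨ₚ-transfer same (ψ ∧ₗ φ) i (a , b)  = ⊨ₚ-transfer same ψ i a , ⊨ₚ-transfer same φ i b
⊨ₚ-transfer same (Xₗ ψ)   i holds    = ⊨ₚ-transfer same ψ (suc i) holds
⊨ₚ-transfer same (ψ Uₗ φ) i (k , φ-at-k , ψ-before) =
  k , ⊨ₚ-transfer same φ _ φ-at-k , λ j j<k → ⊨ₚ-transfer same ψ _ (ψ-before j j<k)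

module _ {x : ℕ} {K K' : Kripke} {Z : Fin (Kripke.n K') → Fin (Kripke.n K) → Set}
         (B : IsXBisim x K K' Z) where
  private
    module K  = Kripke K
    module K' = Kripke K'
  open IsXBisim B

  simulate : ∀ {π'} → IsPath (toStructure K') K'.s₀ π' →
    Σ[ π ∈ (ℕ → Fin K.n) ] IsPath (toStructure K) K.s₀ π × (∀ i → Z (π' i) (π i))
  simulate {π'} (start , steps) =
    proj₁ ∘ follow , (refl , λ i → proj₁ (proj₂ (next i))) , proj₂ ∘ follow
    where
    follow : (i : ℕ) → Σ[ s ∈ Fin K.n ] Z (π' i) s
    next : (i : ℕ) → ∃[ t ] ((K.R (proj₁ (follow i)) t ≡ true) × Z (π' (suc i)) t)
    follow zero    = K.s₀ , subst (λ s' → Z s' K.s₀) (sym start) init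
    follow (suc i) = proj₁ (next i) , proj₂ (proj₂ (next i))
    next i = forth (proj₂ (follow i)) (steps i)

  -- Related states agree on every proposition other than x: inside AP by
  -- the bisimulation, outside AP ∪ {x} both labellings are false.
  agree-off-x : (∀ p → p ∈ K'.AP ⇔ (p ∈ K.AP ⊎ p ≡ x)) →
    ∀ {s' s} → Z s' s → ∀ {p} → p ≢ x → K'.I s' p ≡ K.I s p
  agree-off-x APs {s'} {s} z {p} p≢x with p ∈? K.AP
  ... | yes p∈AP = agree z p p∈AP
  ... | no  p∉AP = trans
    (false-unless (λ e → Equivalence.to (APs p) (K'.I-AP s' p e)) [ p∉AP , p≢x ]′)
    (sym (false-unless (K.I-AP s p) p∉AP))

module _ (K : Kripke) where
  open Kripke K

  depth : ∀ {s} → Node K s → ℕ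
  depth root          = 0
  depth (child ν _ _) = suc (depth ν)

  tree-path⇒path : ∀ {τ} → IsPath (T K) (s₀ , root) τ →
    IsPath (toStructure K) s₀ (proj₁ ∘ τ)
  tree-path⇒path {τ} (start , steps) = cong proj₁ start , λ i → edge-R (steps i)
    where
    edge-R : ∀ {u v} → TreeEdge K u v → R (proj₁ u) (proj₁ v) ≡ true
    edge-R (edge _ _ r) = r

  branch : ∀ {π} → IsPath (toStructure K) s₀ π →
    Σ[ ν ∈ ((i : ℕ) → Node K (π i)) ]
      IsPath (T K) (s₀ , root) (λ i → π i , ν i) × (∀ i → depth (ν i) ≡ i)
  branch {π} (start , steps) = ν , (root-at start , λ i → edge (ν i) _ (steps i)) , depth-ν
    where
    ν : (i : ℕ) → Node K (π i)
    ν zero    = subst (Node K) (sym start) root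
    ν (suc i) = child (ν i) (π (suc i)) (steps i)

    root-at : ∀ {s} (e : s ≡ s₀) → (s , subst (Node K) (sym e) root) ≡ (s₀ , root)
    root-at refl = refl

    root-depth : ∀ {s} (e : s ≡ s₀) → depth (subst (Node K) (sym e) root) ≡ 0
    root-depth refl = refl

    depth-ν : ∀ i → depth (ν i) ≡ i
    depth-ν zero    = root-depth start
    depth-ν (suc i) = cong suc (depth-ν i)

-- (⇒) For K' ∈ B_x(K), every initial path of K' has the trace of a branch
-- of some x-variant of T(K): label the nodes at depth i by x's value at π' i.
bisim-path⇒tree-path : ∀ {x K K'} → XBisimilar x K K' →
  ∀ {π'} → IsPath (toStructure K') (Kripke.s₀ K') π' →
  Σ[ ℓ ∈ (Structure.State (T K) → Bool) ] Σ[ τ ∈ (ℕ → Structure.State (T K)) ]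
    IsPath (variant (T K) x ℓ) (Structure.init (T K)) τ ×
    SameTrace (variant (T K) x ℓ) (toStructure K') τ π'
bisim-path⇒tree-path {x} {K} {K'} (APs , _ , B) {π'} π'-path
  with simulate B π'-path
... | π , π-path , related with branch K π-path
... | ν , τ-path , depth-ν = ℓ , (λ i → π i , ν i) , τ-path , same
  where
  ℓ : Structure.State (T K) → Bool
  ℓ (_ , μ) = Kripke.I K' (π' (depth K μ)) x

  same : SameTrace (variant (T K) x ℓ) (toStructure K') (λ i → π i , ν i) π'
  same i p with p ≟ x
  ... | yes refl = trans (setX-at x (ℓ (π i , ν i)) (Kripke.I K (π i)))
                         (cong (λ j → Kripke.I K' (π' j) x) (depth-ν i))
  ... | no  p≢x  = trans (setX-off (ℓ (π i , ν i)) (Kripke.I K (π i)) p≢x)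
                         (sym (agree-off-x B APs (related i) p≢x))

-- K × Bool: the bit of a state is the value of x, transitions ignore the
-- bit, and b₀ is the initial bit.  States are encoded in Fin (n + n).
module Doubling (K : Kripke) (x : ℕ) where
  open Kripke K

  encode : Fin n → Bool → Fin (n + n)
  encode s false = join n n (inj₁ s)
  encode s true  = join n n (inj₂ s)

  decode : Fin (n + n) → Fin n × Bool
  decode a = [ (λ s → s , false) , (λ s → s , true) ]′ (splitAt n a)

  decode-encode : ∀ s b → decode (encode s b) ≡ (s , b)
  decode-encode s false rewrite splitAt-join n n (inj₁ s) = refl
  decode-encode s true  rewrite splitAt-join n n (inj₂ s) = refl

  state : Fin (n + n) → Fin n
  state = proj₁ ∘ decode

  bit : Fin (n + n) → Bool
  bit = proj₂ ∘ decode

  state-encode : ∀ s b → state (encode s b) ≡ s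
  state-encode s b = cong proj₁ (decode-encode s b)

  bit-encode : ∀ s b → bit (encode s b) ≡ b
  bit-encode s b = cong proj₂ (decode-encode s b)

  doubled : Bool → Kripke
  doubled b₀ = record
    { AP    = x ∷ AP
    ; n     = n + n
    ; R     = λ a c → R (state a) (state c)
    ; total = total′
    ; s₀    = encode s₀ b₀
    ; I     = λ a → setX x (bit a) (I (state a))
    ; I-AP  = λ a → setX-support (I-AP (state a))
    }
    where
    total′ : ∀ a → ∃[ c ] (R (state a) (state c) ≡ true)
    total′ a with total (state a)
    ... | t , r = encode t false
                , subst (λ u → R (state a) u ≡ true) (sym (state-encode t false)) r

  -- Forgetting the bit is an x-bisimulation, as x ∉ AP.
  doubled-∈B : x ∉ AP → ∀ b₀ → XBisimilar x K (doubled b₀)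
  doubled-∈B x∉AP b₀ = APs , (λ a s → state a ≡ s) , record
    { init  = state-encode s₀ b₀
    ; agree = agree′
    ; forth = λ { {t' = c} refl r → state c , r , refl }
    ; back  = λ { {t = t} refl r →
        encode t false
      , subst (λ u → R _ u ≡ true) (sym (state-encode t false)) r
      , state-encode t false }
    }
    where
    APs : ∀ p → p ∈ x ∷ AP ⇔ (p ∈ AP ⊎ p ≡ x)
    APs p = mk⇔ (λ { (here p≡x) → inj₂ p≡x ; (there p∈AP) → inj₁ p∈AP })
                [ there , here ]′

    agree′ : ∀ {a s} → state a ≡ s → ∀ p → p ∈ AP →
      setX x (bit a) (I (state a)) p ≡ I s p
    agree′ {a} refl p p∈AP =
      setX-off (bit a) (I (state a)) (λ p≡x → x∉AP (subst (_∈ AP) p≡x p∈AP))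

  doubled-path : ∀ {π} → IsPath (toStructure K) s₀ π → (β : ℕ → Bool) →
    IsPath (toStructure (doubled (β 0))) (encode s₀ (β 0)) (λ i → encode (π i) (β i))
  doubled-path {π} (start , steps) β =
    cong (λ s → encode s (β 0)) start ,
    λ i → subst₂ (λ u v → R u v ≡ true)
                 (sym (state-encode (π i) (β i)))
                 (sym (state-encode (π (suc i)) (β (suc i))))
                 (steps i)

tree-path⇒bisim-path : ∀ {x K} → x ∉ Kripke.AP K →
  (ℓ : Structure.State (T K) → Bool) →
  ∀ {τ} → IsPath (variant (T K) x ℓ) (Structure.init (T K)) τ →
  Σ[ K' ∈ Kripke ] XBisimilar x K K' ×
    Σ[ π' ∈ (ℕ → Fin (Kripke.n K')) ] IsPath (toStructure K') (Kripke.s₀ K') π' ×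
      SameTrace (toStructure K') (variant (T K) x ℓ) π' τ
tree-path⇒bisim-path {x} {K} x∉AP ℓ {τ} τ-path =
  doubled (ℓ (τ 0)) , doubled-∈B x∉AP (ℓ (τ 0)) ,
  π' , doubled-path (tree-path⇒path K τ-path) (ℓ ∘ τ) , same
  where
  open Doubling K x

  π' : ℕ → Fin (Kripke.n K + Kripke.n K)
  π' i = encode (proj₁ (τ i)) (ℓ (τ i))

  same : SameTrace (toStructure (doubled (ℓ (τ 0)))) (variant (T K) x ℓ) π' τ
  same i p = cong₂ (λ b s → setX x b (Kripke.I K s) p)
                   (bit-encode (proj₁ (τ i)) (ℓ (τ i)))
                   (state-encode (proj₁ (τ i)) (ℓ (τ i)))

theorem6p2 : (ψ : LTL) (x : ℕ) → Occurs x ψ →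
    (K : Kripke) → x ∉ Kripke.AP K →
    (K ⊨T∀ x ·A ψ) ⇔ (K ⊨b∀ x ·A ψ)
theorem6p2 ψ x _ K x∉AP = mk⇔ tree⇒bisim bisim⇒tree
  where
  tree⇒bisim : K ⊨T∀ x ·A ψ → K ⊨b∀ x ·A ψ
  tree⇒bisim tree K' K'∈B π' π'-path with bisim-path⇒tree-path K'∈B π'-path
  ... | ℓ , τ , τ-path , same = ⊨ₚ-transfer same ψ 0 (tree ℓ τ τ-path)

  bisim⇒tree : K ⊨b∀ x ·A ψ → K ⊨T∀ x ·A ψ
  bisim⇒tree bisim ℓ τ τ-path with tree-path⇒bisim-path x∉AP ℓ τ-path
  ... | K' , K'∈B , π' , π'-path , same = ⊨ₚ-transfer same ψ 0 (bisim K' K'∈B π' π'-path)
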